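{- Let $\lambda$ be a partition, $n\in N(\lambda)$, and let $O\in \mathrm{OT}_n(\lambda)$. Let $\mathrm{SSOT}(O)=\{S\in \mathrm{SSOT}_n(\lambda)\mid \mathrm{std}\,S=O\}$. Then the map $\mathrm{com}:\mathrm{SSOT}(O)\to \mathrm{Com}$, $S\mapsto \mathrm{com}(S)=(m_1(S),m_2(S),\dots)$, is injective and weight-preserving, i.e. $x^{S}=x^{\mathrm{com}(S)}$ for all $S\in\mathrm{SSOT}(O)$, where for a weak composition $c=(c_1,c_2,\dots)$ one writes $x^c=x_1^{c_1}x_2^{c_2}\cdots$.
   Context: Partitions are identified with Young diagrams (English convention); a box is a position $(i,j)$ with $i$ the row and $j$ the column index. A skew shape $\mu/\nu$ is a horizontal strip if it has at most one box in each column. For a partition $\lambda$, $N(\lambda)=\{n\in\mathbb Z_{\ge0}: n\ge|\lambda|,\ n\equiv|\lambda|\pmod 2\}$. $\mathrm{Com}$ is the set of weak compositions (finite sequences of nonnegative integers, identified when they differ only by trailing zeros). For partitions write $\nu\lhd\mu$ if $\nu\subset\mu$ and $|\mu|=|\nu|+1$. An oscillating tableau (OT) of shape $\lambda$ and length $n$ is a sequence of partitions $O=(O_0,\dots,O_n)$ with $O_0=\emptyset$, $O_n=\lambda$ and, for each $j$, $O_{j-1}\lhd O_j$ or $O_j\lhd O_{j-1}$; $\mathrm{OT}_n(\lambda)$ is the set of these. A semistandard oscillating tableau (SSOT) of shape $\lambda$ is a sequence of partitions $S=(S^1,S'^2,S^2,S'^3,S^3,\dots)$ such that, with $S^0=S'^1=\emptyset$: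 for all $i\ge1$, $S'^i\subseteq S^{i-1}$, $S'^i\subseteq S^i$, and $S^{i-1}/S'^i$ and $S^i/S'^i$ are (possibly empty) horizontal strips; and there is $k$ with $S^i=S'^{i+1}=\lambda$ for all $i\ge k$. Put $m_i(S)=|S^{i-1}/S'^i|+|S^i/S'^i|$; the length of $S$ is $n=\sum_i m_i(S)$, $\mathrm{com}(S)=(m_1(S),m_2(S),\dots)$, and $x^S=\prod_i x_i^{m_i(S)}$. $\mathrm{SSOT}_n(\lambda)$ is the set of SSOTs of shape $\lambda$ and length $n$. The standardization $\mathrm{std}\,S\in\mathrm{OT}_n(\lambda)$ is the OT obtained by starting from $\emptyset$ and, for $i=1,2,\dots$ in turn, first removing the boxes of $S^{i-1}/S'^i$ one at a time from right to left (in decreasing column order), then adding the boxes of $S^i/S'^i$ one at a time from left to right (in increasing column order). -}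

module Defs where

open import Data.Nat using (ℕ; zero; suc; _+_; _*_; _∸_; _≤_; _<_)
open import Data.Nat.ListAction using (sum)
open import Data.Empty using (⊥)
open import Data.List using (List; []; _∷_; _++_; length; map; concatMap; upTo; downFrom; reverse)
open import Data.List.Relation.Unary.All using (All)
open import Data.Product using (_×_; _,_; ∃)
open import Relation.Binary.PropositionalEquality using (_≡_)
open import Relation.Nullary using (¬_)
open import Data.Sum using (_⊎_)

-- Partitions are represented as lists of row lengths (row 0 = top row),
-- weakly decreasing with all entries positive (no trailing zeros).
-- Rows and columns are 0-indexed: box (i , j) lies in row i, column j.

row : List ℕ → ℕ → ℕ
row []       _       = 0
row (x ∷ xs) zero    = x
row (x ∷ xs) (suc i) = row xs i

IsPartition : List ℕ → Set
IsPartition p = All (0 <_) p × (∀ i → row p (suc i) ≤ row p i)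

size : List ℕ → ℕ
size = sum

_⊆ₚ_ : List ℕ → List ℕ → Set
ν ⊆ₚ μ = ∀ i → row ν i ≤ row μ i

InSkew : List ℕ → List ℕ → ℕ → ℕ → Set
InSkew μ ν i j = (j < row μ i) × (row ν i ≤ j)

HStrip : List ℕ → List ℕ → Set
HStrip μ ν = ∀ i i' j → i < i' → InSkew μ ν i j → ¬ InSkew μ ν i' j

-- number of boxes of μ/ν (for ν ⊆ μ)
skewSize : List ℕ → List ℕ → ℕ
skewSize μ ν = size μ ∸ size ν

InN : List ℕ → ℕ → Set
InN la n = (size la ≤ n) × ∃ λ k → n ≡ size la + 2 * k

_⊲_ : List ℕ → List ℕ → Set
ν ⊲ μ = (ν ⊆ₚ μ) × (size μ ≡ suc (size ν))

data OscSteps : List (List ℕ) → Set where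
  one  : ∀ p → OscSteps (p ∷ [])
  step : ∀ p q rest → (p ⊲ q) ⊎ (q ⊲ p) → OscSteps (q ∷ rest) → OscSteps (p ∷ q ∷ rest)

lastOr : List ℕ → List (List ℕ) → List ℕ
lastOr d []       = d
lastOr d (x ∷ xs) = lastOr x xs

IsOT : ℕ → List ℕ → List (List ℕ) → Set
IsOT n la [] = ⊥
IsOT n la (O₀ ∷ Os) =
  (O₀ ≡ []) × (length Os ≡ n) × (lastOr O₀ Os ≡ la)
  × All IsPartition (O₀ ∷ Os) × OscSteps (O₀ ∷ Os)

-- S i = S^i (i ≥ 0, S^0 = ∅), S' i = S'^i (i ≥ 1, S'^1 = ∅; S'^0 is fixed to ∅
-- as a normalisation, it plays no role).  'bound' is a stabilisation index k.
record SSOT (la : List ℕ) : Set where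
  field
    S      : ℕ → List ℕ
    S'     : ℕ → List ℕ
    S-0    : S 0 ≡ []
    S'-0   : S' 0 ≡ []
    S'-1   : S' 1 ≡ []
    parts  : ∀ i → IsPartition (S i) × IsPartition (S' i)
    strips : ∀ i → (S' (suc i) ⊆ₚ S i) × (S' (suc i) ⊆ₚ S (suc i))
                   × HStrip (S i) (S' (suc i)) × HStrip (S (suc i)) (S' (suc i))
    bound  : ℕ
    stable : ∀ i → bound ≤ i → (S i ≡ la) × (S' (suc i) ≡ la)

open SSOT public

-- m_{i+1}(S)
m : ∀ {la} → SSOT la → ℕ → ℕ
m T i = skewSize (S T i) (S' T (suc i)) + skewSize (S T (suc i)) (S' T (suc i))

-- weak compositions are represented as functions ℕ → ℕ (entry j = (j+1)-th part);
-- com(S) = (m_1(S), m_2(S), …)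
com : ∀ {la} → SSOT la → ℕ → ℕ
com T j = m T j

sumBelow : (ℕ → ℕ) → ℕ → ℕ
sumBelow f zero    = 0
sumBelow f (suc k) = sumBelow f k + f k

-- length of S: Σ_i m_i(S) (m_i = 0 for i > bound)
lengthS : ∀ {la} → SSOT la → ℕ
lengthS T = sumBelow (com T) (bound T)

-- monomials x_1^{e_1} x_2^{e_2} ⋯ represented by their exponent functions
Monomial : Set
Monomial = ℕ → ℕ

xS : ∀ {la} → SSOT la → Monomial
xS T j = m T j

xC : (ℕ → ℕ) → Monomial
xC c j = c j

_≈S_ : ∀ {la} → SSOT la → SSOT la → Set
T ≈S U = ∀ i → (S T i ≡ S U i) × (S' T i ≡ S' U i)

trim : List ℕ → List ℕ
trim [] = []
trim (x ∷ xs) = cons' x (trim xs)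
  where
    cons' : ℕ → List ℕ → List ℕ
    cons' zero []    = []
    cons' y    ys    = y ∷ ys

setRow : ℕ → ℕ → List ℕ → List ℕ
setRow zero    v []       = v ∷ []
setRow zero    v (x ∷ xs) = v ∷ xs
setRow (suc r) v []       = 0 ∷ setRow r v []
setRow (suc r) v (x ∷ xs) = x ∷ setRow r v xs

-- perform elementary steps (r , v) = "set row r to length v", recording
-- each intermediate partition
applySteps : List ℕ → List (ℕ × ℕ) → List (List ℕ)
applySteps cur [] = []
applySteps cur ((r , v) ∷ st) = trim (setRow r v cur) ∷ applySteps (trim (setRow r v cur)) st

-- removing the boxes of the horizontal strip μ/ν one at a time from right to
-- left (decreasing column order = top row first, each row right to left)
removeSteps : List ℕ → List ℕ → List (ℕ × ℕ)
removeSteps μ ν = concatMap (λ r → map (λ k → (r , row ν r + k)) (downFrom (row μ r ∸ row ν r)))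
                            (upTo (length μ))

-- adding the boxes of the horizontal strip μ/ν one at a time from left to
-- right (increasing column order = bottom row first, each row left to right)
addSteps : List ℕ → List ℕ → List (ℕ × ℕ)
addSteps μ ν = concatMap (λ r → map (λ k → (r , suc (row ν r + k))) (upTo (row μ r ∸ row ν r)))
                         (reverse (upTo (length μ)))

-- steps for index i = j+1: remove S^{j}/S'^{j+1}, then add S^{j+1}/S'^{j+1}
stepsAt : ∀ {la} → SSOT la → ℕ → List (ℕ × ℕ)
stepsAt T j = removeSteps (S T j) (S' T (suc j)) ++ addSteps (S T (suc j)) (S' T (suc j))

std : ∀ {la} → SSOT la → List (List ℕ)
std T = [] ∷ applySteps [] (concatMap (stepsAt T) (upTo (bound T)))

-- The standardization of S passes through S^0, S'^1, S^1, S'^2, S^2, … in this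
-- order, spending |S^{i-1}/S'^i| steps to go down to S'^i and |S^i/S'^i| steps
-- to come back up to S^i. Hence com S = (m_1, m_2, …) locates every S^i in
-- std S: it is reached after m_1 + ⋯ + m_i steps. Once S^{i-1} and S^i are
-- known, m_i = |S^{i-1}| + |S^i| − 2|S'^i| determines |S'^i|, hence also the
-- position of S'^i in std S. So std S and com S determine S.
module Submission where

open import Defs
open import Data.Nat using (ℕ; zero; suc; _+_; _*_; _∸_; _≤_; _<_; _≟_; _<?_; z≤n; s≤s)
open import Data.Nat.Properties
open import Data.Nat.ListAction using (sum)
open import Data.Nat.ListAction.Properties using (sum-↭)
open import Data.Nat.Tactic.RingSolver using (solve-∀)
open import Data.Empty using (⊥-elim)
open import Data.List
  using (List; []; _∷_; _++_; length; map; concatMap; foldl; upTo; downFrom; reverse; applyUpTo)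
open import Data.List.Properties
  using (length-++; length-map; length-upTo; length-downFrom; foldl-++; map-upTo; map-cong; reverse-map; ∷-injective; ∷-injectiveʳ)
open import Data.List.Relation.Unary.All using (All; _∷_)
open import Data.List.Relation.Unary.Any using (here; there)
open import Data.List.Relation.Unary.Any.Properties using (reverse⁺)
open import Data.List.Membership.Propositional using (_∈_)
open import Data.List.Membership.Propositional.Properties using (∈-upTo⁺)
open import Data.List.Relation.Binary.Permutation.Propositional.Properties using (↭-reverse)
open import Data.Product using (_×_; _,_; proj₁; proj₂; uncurry)
open import Data.Sum using (_⊎_; inj₁; inj₂; [_,_]′)
open import Function using (_∘_; _$_; id)
open import Relation.Binary.PropositionalEquality
open import Relation.Nullary using (yes; no)

private
  variable
    A B : Set

update : (ℕ → ℕ) → ℕ → ℕ → ℕ → ℕ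
update f r v i with i ≟ r
... | yes _ = v
... | no  _ = f i

update-≡ : ∀ f r v → update f r v r ≡ v
update-≡ f r v with r ≟ r
... | yes _  = refl
... | no r≢r = ⊥-elim (r≢r refl)

update-≢ : ∀ f r v {i} → i ≢ r → update f r v i ≡ f i
update-≢ f r v {i} i≢r with i ≟ r
... | yes i≡r = ⊥-elim (i≢r i≡r)
... | no  _   = refl

update-cong : ∀ {f g} r v → f ≗ g → update f r v ≗ update g r v
update-cong r v f≗g i with i ≟ r
... | yes _ = refl
... | no  _ = f≗g i

update-suc : ∀ f r v i → update f (suc r) v (suc i) ≡ update (f ∘ suc) r v i
update-suc f r v i with i ≟ r
... | yes refl = update-≡ f (suc r) v
... | no  i≢r  = update-≢ f (suc r) v (i≢r ∘ suc-injective)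

updates : (ℕ → ℕ) → List (ℕ × ℕ) → ℕ → ℕ
updates = foldl (λ f → uncurry (update f))

updates-cong : ∀ {f g} st → f ≗ g → updates f st ≗ updates g st
updates-cong []             f≗g = f≗g
updates-cong ((r , v) ∷ st) f≗g = updates-cong st (update-cong r v f≗g)

updates-++ : ∀ f xs ys → updates f (xs ++ ys) ≡ updates (updates f xs) ys
updates-++ = foldl-++ _

updates-row-others : ∀ (h : A → ℕ) r ks f {i} → i ≢ r → updates f (map (λ k → (r , h k)) ks) i ≡ f i
updates-row-others h r []       f i≢r = refl
updates-row-others h r (k ∷ ks) f i≢r =
  trans (updates-row-others h r ks _ i≢r) (update-≢ f r (h k) i≢r)

updates-row-downFrom : ∀ (h : ℕ → ℕ) r n f → updates f (map (λ k → (r , h k)) (downFrom (suc n))) r ≡ h 0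
updates-row-downFrom h r zero    f = update-≡ f r (h 0)
updates-row-downFrom h r (suc n) f = updates-row-downFrom h r n _

updates-row-applyUpTo : ∀ (h g : ℕ → ℕ) r n f →
  updates f (map (λ k → (r , h k)) (applyUpTo g (suc n))) r ≡ h (g n)
updates-row-applyUpTo h g r zero    f = update-≡ f r (h (g 0))
updates-row-applyUpTo h g r (suc n) f = updates-row-applyUpTo h (g ∘ suc) r n _

-- The invariant Between (every row is at `from` or at `to`) spares us from
-- requiring the rows listed to be distinct.
module RowByRow (block : ℕ → List (ℕ × ℕ)) (from to : ℕ → ℕ)
  (block-others : ∀ r f {i} → i ≢ r → updates f (block r) i ≡ f i)
  (block-own : ∀ r f → f r ≡ from r ⊎ f r ≡ to r → updates f (block r) r ≡ to r)
  where

  Between : (ℕ → ℕ) → Set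
  Between f = ∀ i → f i ≡ from i ⊎ f i ≡ to i

  between-block : ∀ r f → Between f → Between (updates f (block r))
  between-block r f between i with i ≟ r
  ... | yes refl = inj₂ (block-own r f (between r))
  ... | no  i≢r  rewrite block-others r f i≢r = between i

  done-block : ∀ r f {i} → f i ≡ to i → updates f (block r) i ≡ to i
  done-block r f {i} fi≡to with i ≟ r
  ... | yes refl = block-own r f (inj₂ fi≡to)
  ... | no  i≢r  = trans (block-others r f i≢r) fi≡to

  done-blocks : ∀ rs f {i} → f i ≡ to i → updates f (concatMap block rs) i ≡ to i
  done-blocks []       f fi≡to = fi≡to
  done-blocks (r ∷ rs) f {i} fi≡to rewrite updates-++ f (block r) (concatMap block rs) =
    done-blocks rs _ (done-block r f fi≡to)

  reached-blocks : ∀ rs f {i} → Between f → i ∈ rs → updates f (concatMap block rs) i ≡ to i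
  reached-blocks (r ∷ rs) f between (here refl) rewrite updates-++ f (block r) (concatMap block rs) =
    done-blocks rs _ (block-own r f (between r))
  reached-blocks (r ∷ rs) f between (there i∈rs) rewrite updates-++ f (block r) (concatMap block rs) =
    reached-blocks rs _ (between-block r f between) i∈rs

  updates-blocks : ∀ rs → (∀ i → i ∈ rs ⊎ from i ≡ to i) → updates from (concatMap block rs) ≗ to
  updates-blocks rs covered i with covered i
  ... | inj₁ i∈rs    = reached-blocks rs from (λ _ → inj₁ refl) i∈rs
  ... | inj₂ from≡to = done-blocks rs from from≡to

row-setRow : ∀ r v xs → row (setRow r v xs) ≗ update (row xs) r v
row-setRow zero    v []       zero    = refl
row-setRow zero    v []       (suc i) = refl
row-setRow zero    v (x ∷ xs) zero    = refl
row-setRow zero    v (x ∷ xs) (suc i) = refl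
row-setRow (suc r) v []       zero    = refl
row-setRow (suc r) v []       (suc i) = trans (row-setRow r v [] i) (sym (update-suc _ r v i))
row-setRow (suc r) v (x ∷ xs) zero    = refl
row-setRow (suc r) v (x ∷ xs) (suc i) = trans (row-setRow r v xs i) (sym (update-suc _ r v i))

row-trim : ∀ xs → row (trim xs) ≗ row xs
row-trim []       i = refl
row-trim (x ∷ xs) i with trim xs | row-trim xs
row-trim (zero  ∷ xs) zero    | []    | _  = refl
row-trim (zero  ∷ xs) (suc i) | []    | ih = ih i
row-trim (suc x ∷ xs) zero    | []    | _  = refl
row-trim (suc x ∷ xs) (suc i) | []    | ih = ih i
row-trim (zero  ∷ xs) zero    | _ ∷ _ | _  = refl
row-trim (zero  ∷ xs) (suc i) | _ ∷ _ | ih = ih i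
row-trim (suc x ∷ xs) zero    | _ ∷ _ | _  = refl
row-trim (suc x ∷ xs) (suc i) | _ ∷ _ | ih = ih i

row-beyond-length : ∀ xs {i} → length xs ≤ i → row xs i ≡ 0
row-beyond-length []       _             = refl
row-beyond-length (x ∷ xs) {suc i} (s≤s ℓ≤i) = row-beyond-length xs ℓ≤i

rows-injective : ∀ {xs ys} → All (0 <_) xs → All (0 <_) ys → row xs ≗ row ys → xs ≡ ys
rows-injective {[]}     {[]}     _          _          _    = refl
rows-injective {[]}     {y ∷ ys} _          (0<y ∷ _)  rows = ⊥-elim (<-irrefl (rows 0) 0<y)
rows-injective {x ∷ xs} {[]}     (0<x ∷ _)  _          rows = ⊥-elim (<-irrefl (sym (rows 0)) 0<x)
rows-injective {x ∷ xs} {y ∷ ys} (_ ∷ pxs)  (_ ∷ pys)  rows =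
  cong₂ _∷_ (rows 0) (rows-injective pxs pys (rows ∘ suc))

applyStep : List ℕ → ℕ × ℕ → List ℕ
applyStep c (r , v) = trim (setRow r v c)

final : List ℕ → List (ℕ × ℕ) → List ℕ
final = foldl applyStep

row-final : ∀ st c → row (final c st) ≗ updates (row c) st
row-final []             c i = refl
row-final ((r , v) ∷ st) c i =
  trans (row-final st (applyStep c (r , v)) i)
        (updates-cong st (λ j → trans (row-trim (setRow r v c) j) (row-setRow r v c j)) i)

lastOr-applySteps : ∀ c st → lastOr c (applySteps c st) ≡ final c st
lastOr-applySteps c []             = refl
lastOr-applySteps c ((r , v) ∷ st) = lastOr-applySteps (applyStep c (r , v)) st

length-applySteps : ∀ c st → length (applySteps c st) ≡ length st
length-applySteps c []             = refl
length-applySteps c ((r , v) ∷ st) = cong suc (length-applySteps _ st)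

applySteps-++ : ∀ c xs ys → applySteps c (xs ++ ys) ≡ applySteps c xs ++ applySteps (final c xs) ys
applySteps-++ c []             ys = refl
applySteps-++ c ((r , v) ∷ xs) ys = cong (_ ∷_) (applySteps-++ _ xs ys)

++-cancel-length : ∀ (xs xs' : List A) {ys ys'} → length xs ≡ length xs' →
  xs ++ ys ≡ xs' ++ ys' → xs ≡ xs' × ys ≡ ys'
++-cancel-length []       []        _  eq = refl , eq
++-cancel-length (x ∷ xs) (x' ∷ xs') ℓ eq with ∷-injective eq
... | x≡x' , rest with ++-cancel-length xs xs' (suc-injective ℓ) rest
...   | xs≡xs' , ys≡ys' = cong₂ _∷_ x≡x' xs≡xs' , ys≡ys'

applySteps-++-cancel : ∀ c xs xs' {ys ys'} → length xs ≡ length xs' →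
  applySteps c (xs ++ ys) ≡ applySteps c (xs' ++ ys') →
  applySteps c xs ≡ applySteps c xs' × applySteps (final c xs) ys ≡ applySteps (final c xs') ys'
applySteps-++-cancel c xs xs' {ys} {ys'} ℓ eq =
  ++-cancel-length (applySteps c xs) (applySteps c xs')
    (trans (length-applySteps c xs) (trans ℓ (sym (length-applySteps c xs'))))
    (trans (sym (applySteps-++ c xs ys)) (trans eq (applySteps-++ c xs' ys')))

final-cong-applySteps : ∀ c xs xs' → applySteps c xs ≡ applySteps c xs' → final c xs ≡ final c xs'
final-cong-applySteps c xs xs' eq =
  trans (sym (lastOr-applySteps c xs)) (trans (cong (lastOr c) eq) (lastOr-applySteps c xs'))

rowGap : List ℕ → List ℕ → ℕ → ℕ
rowGap μ ν r = row μ r ∸ row ν r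

length-concatMap : ∀ (f : A → List B) xs → length (concatMap f xs) ≡ sum (map (length ∘ f) xs)
length-concatMap f []       = refl
length-concatMap f (x ∷ xs) = trans (length-++ (f x)) (cong (length (f x) +_) (length-concatMap f xs))

length-⊆ₚ : ∀ μ ν → All (0 <_) ν → ν ⊆ₚ μ → length ν ≤ length μ
length-⊆ₚ μ        []       _         _   = z≤n
length-⊆ₚ []       (y ∷ ys) (0<y ∷ _) ν⊆μ = ⊥-elim (<-irrefl refl (≤-trans 0<y (ν⊆μ 0)))
length-⊆ₚ (x ∷ xs) (y ∷ ys) (_ ∷ pys) ν⊆μ = s≤s (length-⊆ₚ xs ys pys (ν⊆μ ∘ suc))

rowGaps-+-size : ∀ μ ν → ν ⊆ₚ μ → length ν ≤ length μ →
  sum (applyUpTo (rowGap μ ν) (length μ)) + size ν ≡ size μ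
rowGaps-+-size []       []       _   _          = refl
rowGaps-+-size (x ∷ xs) []       _   _          =
  trans (+-identityʳ _) (cong (x +_) (trans (sym (+-identityʳ _)) (rowGaps-+-size xs [] (λ _ → z≤n) z≤n)))
rowGaps-+-size (x ∷ xs) (y ∷ ys) ν⊆μ (s≤s ℓ≤ℓ) = begin
  ((x ∸ y) + G) + (y + size ys) ≡⟨ regroup (x ∸ y) G y (size ys) ⟩
  ((x ∸ y) + y) + (G + size ys) ≡⟨ cong₂ _+_ (m∸n+n≡m (ν⊆μ 0)) (rowGaps-+-size xs ys (ν⊆μ ∘ suc) ℓ≤ℓ) ⟩
  x + size xs                   ∎
  where
  open ≡-Reasoning
  G : ℕ
  G = sum (applyUpTo (rowGap xs ys) (length xs))
  regroup : ∀ a g b s → (a + g) + (b + s) ≡ (a + b) + (g + s)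
  regroup = solve-∀

skewSize-+-size : ∀ μ ν → All (0 <_) ν → ν ⊆ₚ μ → skewSize μ ν + size ν ≡ size μ
skewSize-+-size μ ν ν>0 ν⊆μ = m∸n+n≡m (subst (size ν ≤_) gaps (m≤n+m (size ν) _))
  where
  gaps : sum (applyUpTo (rowGap μ ν) (length μ)) + size ν ≡ size μ
  gaps = rowGaps-+-size μ ν ν⊆μ (length-⊆ₚ μ ν ν>0 ν⊆μ)

sum-rowGaps : ∀ μ ν → All (0 <_) ν → ν ⊆ₚ μ → sum (map (rowGap μ ν) (upTo (length μ))) ≡ skewSize μ ν
sum-rowGaps μ ν ν>0 ν⊆μ = begin
  sum (map (rowGap μ ν) (upTo (length μ)))                 ≡⟨ cong sum (map-upTo (rowGap μ ν) (length μ)) ⟩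
  G                                                        ≡⟨ sym (m+n∸n≡m G (size ν)) ⟩
  G + size ν ∸ size ν                                      ≡⟨ cong (_∸ size ν) (rowGaps-+-size μ ν ν⊆μ (length-⊆ₚ μ ν ν>0 ν⊆μ)) ⟩
  skewSize μ ν                                             ∎
  where
  open ≡-Reasoning
  G : ℕ
  G = sum (applyUpTo (rowGap μ ν) (length μ))

length-removeSteps : ∀ μ ν → All (0 <_) ν → ν ⊆ₚ μ → length (removeSteps μ ν) ≡ skewSize μ ν
length-removeSteps μ ν ν>0 ν⊆μ = begin
  length (removeSteps μ ν)                        ≡⟨ length-concatMap _ (upTo (length μ)) ⟩
  sum (map _ (upTo (length μ)))                   ≡⟨ cong sum (map-cong gap (upTo (length μ))) ⟩
  sum (map (rowGap μ ν) (upTo (length μ)))        ≡⟨ sum-rowGaps μ ν ν>0 ν⊆μ ⟩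
  skewSize μ ν                                    ∎
  where
  open ≡-Reasoning
  gap : ∀ r → length (map (λ k → (r , row ν r + k)) (downFrom (rowGap μ ν r))) ≡ rowGap μ ν r
  gap r = trans (length-map _ (downFrom (rowGap μ ν r))) (length-downFrom (rowGap μ ν r))

length-addSteps : ∀ μ ν → All (0 <_) ν → ν ⊆ₚ μ → length (addSteps μ ν) ≡ skewSize μ ν
length-addSteps μ ν ν>0 ν⊆μ = begin
  length (addSteps μ ν)                           ≡⟨ length-concatMap _ (reverse (upTo (length μ))) ⟩
  sum (map _ (reverse (upTo (length μ))))         ≡⟨ cong sum (reverse-map _ (upTo (length μ))) ⟩
  sum (reverse (map _ (upTo (length μ))))         ≡⟨ sum-↭ (↭-reverse (map _ (upTo (length μ)))) ⟩
  sum (map _ (upTo (length μ)))                   ≡⟨ cong sum (map-cong gap (upTo (length μ))) ⟩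
  sum (map (rowGap μ ν) (upTo (length μ)))        ≡⟨ sum-rowGaps μ ν ν>0 ν⊆μ ⟩
  skewSize μ ν                                    ∎
  where
  open ≡-Reasoning
  gap : ∀ r → length (map (λ k → (r , suc (row ν r + k))) (upTo (rowGap μ ν r))) ≡ rowGap μ ν r
  gap r = trans (length-map _ (upTo (rowGap μ ν r))) (length-upTo (rowGap μ ν r))

rowGap≡0 : ∀ μ ν r → ν ⊆ₚ μ → rowGap μ ν r ≡ 0 → row μ r ≡ row ν r
rowGap≡0 μ ν r ν⊆μ gap = ≤-antisym (m∸n≡0⇒m≤n gap) (ν⊆μ r)

upTo-length-covers : ∀ μ ν → ν ⊆ₚ μ → ∀ i → i ∈ upTo (length μ) ⊎ row μ i ≡ row ν i
upTo-length-covers μ ν ν⊆μ i with i <? length μ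
... | yes i<ℓ = inj₁ (∈-upTo⁺ i<ℓ)
... | no  i≮ℓ = inj₂ (trans μ₀ (sym (n≤0⇒n≡0 (subst (row ν i ≤_) μ₀ (ν⊆μ i)))))
  where
  μ₀ : row μ i ≡ 0
  μ₀ = row-beyond-length μ (≮⇒≥ i≮ℓ)

updates-removeSteps : ∀ μ ν → ν ⊆ₚ μ → updates (row μ) (removeSteps μ ν) ≗ row ν
updates-removeSteps μ ν ν⊆μ = updates-blocks (upTo (length μ)) (upTo-length-covers μ ν ν⊆μ)
  where
  block : ℕ → List (ℕ × ℕ)
  block r = map (λ k → (r , row ν r + k)) (downFrom (row μ r ∸ row ν r))
  own : ∀ r f → f r ≡ row μ r ⊎ f r ≡ row ν r → updates f (block r) r ≡ row ν r
  own r f at with row μ r ∸ row ν r in gap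
  ... | zero  = [ (λ at-μ → trans at-μ (rowGap≡0 μ ν r ν⊆μ gap)) , id ]′ at
  ... | suc d = trans (updates-row-downFrom (row ν r +_) r d f) (+-identityʳ (row ν r))
  open RowByRow block (row μ) (row ν) (λ r → updates-row-others (row ν r +_) r (downFrom (rowGap μ ν r))) own

updates-addSteps : ∀ μ ν → ν ⊆ₚ μ → updates (row ν) (addSteps μ ν) ≗ row μ
updates-addSteps μ ν ν⊆μ = updates-blocks (reverse (upTo (length μ))) covers
  where
  block : ℕ → List (ℕ × ℕ)
  block r = map (λ k → (r , suc (row ν r + k))) (upTo (row μ r ∸ row ν r))
  own : ∀ r f → f r ≡ row ν r ⊎ f r ≡ row μ r → updates f (block r) r ≡ row μ r
  own r f at with row μ r ∸ row ν r in gap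
  ... | zero  = [ (λ at-ν → trans at-ν (sym (rowGap≡0 μ ν r ν⊆μ gap))) , id ]′ at
  ... | suc d = begin
    updates f (map (λ k → (r , suc (row ν r + k))) (upTo (suc d))) r ≡⟨ updates-row-applyUpTo _ id r d f ⟩
    suc (row ν r + d)                                                 ≡⟨ +-suc (row ν r) d ⟨
    row ν r + suc d                                                   ≡⟨ cong (row ν r +_) gap ⟨
    row ν r + (row μ r ∸ row ν r)                                     ≡⟨ m+[n∸m]≡n (ν⊆μ r) ⟩
    row μ r                                                           ∎
    where open ≡-Reasoning
  covers : ∀ i → i ∈ reverse (upTo (length μ)) ⊎ row ν i ≡ row μ i
  covers i = [ inj₁ ∘ reverse⁺ , inj₂ ∘ sym ]′ (upTo-length-covers μ ν ν⊆μ i)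
  open RowByRow block (row ν) (row μ) (λ r → updates-row-others (suc ∘ (row ν r +_)) r (upTo (rowGap μ ν r))) own

concatMap-[] : ∀ (f : A → List B) xs → (∀ x → f x ≡ []) → concatMap f xs ≡ []
concatMap-[] f []       f≡[] = refl
concatMap-[] f (x ∷ xs) f≡[] = trans (cong (_++ concatMap f xs) (f≡[] x)) (concatMap-[] f xs f≡[])

removeSteps-self : ∀ μ → removeSteps μ μ ≡ []
removeSteps-self μ = concatMap-[] _ (upTo (length μ))
  (λ r → cong (map (λ k → (r , row μ r + k)) ∘ downFrom) (n∸n≡0 (row μ r)))

addSteps-self : ∀ μ → addSteps μ μ ≡ []
addSteps-self μ = concatMap-[] _ (reverse (upTo (length μ)))
  (λ r → cong (map (λ k → (r , suc (row μ r + k))) ∘ upTo) (n∸n≡0 (row μ r)))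

removed-determined : ∀ {r a x r' a' y p q} → r + x ≡ p → a + x ≡ q → r' + y ≡ p → a' + y ≡ q →
  r + a ≡ r' + a' → r ≡ r'
removed-determined {r} {a} {x} {r'} {a'} {y} {p} {q} e₁ e₂ e₃ e₄ e =
  +-cancelʳ-≡ x r r' (trans e₁ (trans (sym e₃) (cong (r' +_) (sym x≡y))))
  where
  open ≡-Reasoning
  regroup : ∀ u v w → (u + w) + (v + w) ≡ (u + v) + 2 * w
  regroup = solve-∀
  x≡y : x ≡ y
  x≡y = *-cancelˡ-≡ x y 2 (+-cancelˡ-≡ (r + a) _ _ (begin
    (r + a) + 2 * x     ≡⟨ regroup r a x ⟨
    (r + x) + (a + x)   ≡⟨ cong₂ _+_ (trans e₁ (sym e₃)) (trans e₂ (sym e₄)) ⟩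
    (r' + y) + (a' + y) ≡⟨ regroup r' a' y ⟩
    (r' + a') + 2 * y   ≡⟨ cong (_+ 2 * y) e ⟨
    (r + a) + 2 * y     ∎))

module _ {la : List ℕ} (T : SSOT la) where

  S-positive : ∀ i → All (0 <_) (S T i)
  S-positive i = proj₁ (proj₁ (parts T i))

  S'-positive : ∀ i → All (0 <_) (S' T i)
  S'-positive i = proj₁ (proj₂ (parts T i))

  removal : ℕ → List (ℕ × ℕ)
  removal j = removeSteps (S T j) (S' T (suc j))

  addition : ℕ → List (ℕ × ℕ)
  addition j = addSteps (S T (suc j)) (S' T (suc j))

  removed-size : ∀ j → skewSize (S T j) (S' T (suc j)) + size (S' T (suc j)) ≡ size (S T j)
  removed-size j = skewSize-+-size (S T j) (S' T (suc j)) (S'-positive (suc j)) (proj₁ (strips T j))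

  added-size : ∀ j → skewSize (S T (suc j)) (S' T (suc j)) + size (S' T (suc j)) ≡ size (S T (suc j))
  added-size j = skewSize-+-size (S T (suc j)) (S' T (suc j)) (S'-positive (suc j)) (proj₁ (proj₂ (strips T j)))

  length-removal : ∀ j → length (removal j) ≡ skewSize (S T j) (S' T (suc j))
  length-removal j = length-removeSteps (S T j) (S' T (suc j)) (S'-positive (suc j)) (proj₁ (strips T j))

  length-stepsAt : ∀ j → length (stepsAt T j) ≡ m T j
  length-stepsAt j = trans (length-++ (removal j))
    (cong₂ _+_ (length-removal j) (length-addSteps (S T (suc j)) (S' T (suc j)) (S'-positive (suc j)) (proj₁ (proj₂ (strips T j)))))

  updates-removal : ∀ j {f} → f ≗ row (S T j) → updates f (removal j) ≗ row (S' T (suc j))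
  updates-removal j f≗S i =
    trans (updates-cong (removal j) f≗S i) (updates-removeSteps (S T j) (S' T (suc j)) (proj₁ (strips T j)) i)

  updates-stepsAt : ∀ j {f} → f ≗ row (S T j) → updates f (stepsAt T j) ≗ row (S T (suc j))
  updates-stepsAt j {f} f≗S i = begin
    updates f (removal j ++ addition j) i              ≡⟨ cong-app (updates-++ f (removal j) (addition j)) i ⟩
    updates (updates f (removal j)) (addition j) i     ≡⟨ updates-cong (addition j) (updates-removal j f≗S) i ⟩
    updates (row (S' T (suc j))) (addition j) i        ≡⟨ updates-addSteps (S T (suc j)) (S' T (suc j)) (proj₁ (proj₂ (strips T j))) i ⟩
    row (S T (suc j)) i                                ∎
    where open ≡-Reasoning

  stepsFrom : ℕ → ℕ → List (ℕ × ℕ)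
  stepsFrom j zero    = []
  stepsFrom j (suc k) = stepsAt T j ++ stepsFrom (suc j) k

  stepsAt-stable : ∀ {j} → bound T ≤ j → stepsAt T j ≡ []
  stepsAt-stable {j} b≤j = trans
    (cong₂ _++_ (cong₂ removeSteps S-la S'-la) (cong₂ addSteps (proj₁ (stable T (suc j) (m≤n⇒m≤1+n b≤j))) S'-la))
    (cong₂ _++_ (removeSteps-self la) (addSteps-self la))
    where
    S-la : S T j ≡ la
    S-la = proj₁ (stable T j b≤j)
    S'-la : S' T (suc j) ≡ la
    S'-la = proj₂ (stable T j b≤j)

  stepsFrom-stable : ∀ j k → bound T ≤ j → stepsFrom j k ≡ []
  stepsFrom-stable j zero    b≤j = refl
  stepsFrom-stable j (suc k) b≤j =
    cong₂ _++_ (stepsAt-stable b≤j) (stepsFrom-stable (suc j) k (m≤n⇒m≤1+n b≤j))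

  stepsFrom-+ : ∀ j k e → bound T ≤ j + k → stepsFrom j (k + e) ≡ stepsFrom j k
  stepsFrom-+ j zero    e b≤j = stepsFrom-stable j e (subst (bound T ≤_) (+-identityʳ j) b≤j)
  stepsFrom-+ j (suc k) e b≤j =
    cong (stepsAt T j ++_) (stepsFrom-+ (suc j) k e (subst (bound T ≤_) (+-suc j k) b≤j))

  concatMap-stepsAt : ∀ f j k → (∀ x → f x ≡ j + x) → concatMap (stepsAt T) (applyUpTo f k) ≡ stepsFrom j k
  concatMap-stepsAt f j zero    f≡ = refl
  concatMap-stepsAt f j (suc k) f≡ = cong₂ _++_
    (cong (stepsAt T) (trans (f≡ 0) (+-identityʳ j)))
    (concatMap-stepsAt (f ∘ suc) (suc j) k (λ x → trans (f≡ (suc x)) (+-suc j x)))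

  std-stepsFrom : ∀ {k} → bound T ≤ k → std T ≡ [] ∷ applySteps [] (stepsFrom 0 k)
  std-stepsFrom {k} b≤k = cong (λ st → [] ∷ applySteps [] st) (begin
    concatMap (stepsAt T) (upTo (bound T))   ≡⟨ concatMap-stepsAt id 0 (bound T) (λ _ → refl) ⟩
    stepsFrom 0 (bound T)                    ≡⟨ stepsFrom-+ 0 (bound T) (k ∸ bound T) ≤-refl ⟨
    stepsFrom 0 (bound T + (k ∸ bound T))    ≡⟨ cong (stepsFrom 0) (m+[n∸m]≡n b≤k) ⟩
    stepsFrom 0 k                            ∎)
    where open ≡-Reasoning

module StdInjective {la : List ℕ} (T U : SSOT la) (same-m : ∀ j → m T j ≡ m U j) (same-std : std T ≡ std U)
  where

  horizon : ℕ
  horizon = bound T + bound U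

  -- c is the diagram std reaches after j blocks. It is compared with S^j only
  -- row by row, so the normalisation by trim never has to be undone.
  record Agree (j k : ℕ) : Set where
    constructor agreeing
    field
      c      : List ℕ
      rows-T : row c ≗ row (S T j)
      rows-U : row c ≗ row (S U j)
      traces : applySteps c (stepsFrom T j k) ≡ applySteps c (stepsFrom U j k)

  agree-start : ∀ {k} → horizon ≤ k → Agree 0 k
  agree-start h≤k = agreeing [] (starts-empty T) (starts-empty U) $
    ∷-injectiveʳ (trans (sym (std-stepsFrom T (≤-trans (m≤m+n _ _) h≤k)))
                        (trans same-std (std-stepsFrom U (≤-trans (m≤n+m _ _) h≤k))))
    where
    starts-empty : ∀ X → row [] ≗ row (S X 0)
    starts-empty X i = cong (λ s → row s i) (sym (S-0 X))

  agree-S : ∀ {j k} → Agree j k → S T j ≡ S U j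
  agree-S {j} (agreeing c rows-T rows-U _) =
    rows-injective (S-positive T j) (S-positive U j) (λ i → trans (sym (rows-T i)) (rows-U i))

  same-block-length : ∀ j → length (stepsAt T j) ≡ length (stepsAt U j)
  same-block-length j = trans (length-stepsAt T j) (trans (same-m j) (sym (length-stepsAt U j)))

  agree-next : ∀ {j k} → Agree j (suc k) → Agree (suc j) k
  agree-next {j} {k} (agreeing c rows-T rows-U traces)
    with applySteps-++-cancel c (stepsAt T j) (stepsAt U j) (same-block-length j) traces
  ... | block-traces , rest = agreeing (final c (stepsAt T j)) rows-T′ rows-U′ $
    trans rest (cong (λ d → applySteps d (stepsFrom U (suc j) k)) (sym same-final))
    where
    same-final : final c (stepsAt T j) ≡ final c (stepsAt U j)
    same-final = final-cong-applySteps c (stepsAt T j) (stepsAt U j) block-traces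
    rows-T′ : row (final c (stepsAt T j)) ≗ row (S T (suc j))
    rows-T′ i = trans (row-final (stepsAt T j) c i) (updates-stepsAt T j rows-T i)
    rows-U′ : row (final c (stepsAt T j)) ≗ row (S U (suc j))
    rows-U′ i = trans (cong (λ d → row d i) same-final)
                      (trans (row-final (stepsAt U j) c i) (updates-stepsAt U j rows-U i))

  -- |S'^{j+1}| is determined by |S^j|, |S^{j+1}| and m_{j+1}, hence so is the
  -- number of removal steps, and S'^{j+1} is where the removal steps end.
  agree-S' : ∀ {j k} → Agree j (suc k) → S' T (suc j) ≡ S' U (suc j)
  agree-S' {j} {k} a@(agreeing c rows-T rows-U traces) =
    rows-injective (S'-positive T (suc j)) (S'-positive U (suc j)) rows
    where
    open ≡-Reasoning
    block-traces : applySteps c (stepsAt T j) ≡ applySteps c (stepsAt U j)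
    block-traces = proj₁ (applySteps-++-cancel c (stepsAt T j) (stepsAt U j) (same-block-length j) traces)
    same-removed : length (removal T j) ≡ length (removal U j)
    same-removed = trans (length-removal T j) (trans
      (removed-determined (removed-size T j) (added-size T j)
         (trans (removed-size U j) (cong size (sym (agree-S a))))
         (trans (added-size U j) (cong size (sym (agree-S (agree-next a)))))
         (same-m j))
      (sym (length-removal U j)))
    same-final : final c (removal T j) ≡ final c (removal U j)
    same-final = final-cong-applySteps c (removal T j) (removal U j)
      (proj₁ (applySteps-++-cancel c (removal T j) (removal U j) same-removed block-traces))
    rows : row (S' T (suc j)) ≗ row (S' U (suc j))
    rows i = begin
      row (S' T (suc j)) i               ≡⟨ updates-removal T j rows-T i ⟨
      updates (row c) (removal T j) i    ≡⟨ row-final (removal T j) c i ⟨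
      row (final c (removal T j)) i      ≡⟨ cong (λ d → row d i) same-final ⟩
      row (final c (removal U j)) i      ≡⟨ row-final (removal U j) c i ⟩
      updates (row c) (removal U j) i    ≡⟨ updates-removal U j rows-U i ⟩
      row (S' U (suc j)) i               ∎

  agree-from-start : ∀ j k → Agree 0 (j + k) → Agree j k
  agree-from-start zero    k a = a
  agree-from-start (suc j) k a = agree-next (agree-from-start j (suc k) (subst (Agree 0) (sym (+-suc j k)) a))

  agree : ∀ j → Agree j (suc horizon)
  agree j = agree-from-start j (suc horizon) (agree-start (≤-trans (n≤1+n horizon) (m≤n+m _ j)))

  std-injective : T ≈S U
  std-injective i = agree-S (agree i) , same-S' i
    where
    same-S' : ∀ i → S' T i ≡ S' U i
    same-S' zero    = trans (S'-0 T) (sym (S'-0 U))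
    same-S' (suc i) = agree-S' (agree i)

lemma2p18 : (la : List ℕ) → IsPartition la → (n : ℕ) → InN la n →
    (O : List (List ℕ)) → IsOT n la O →
    ((T U : SSOT la) → lengthS T ≡ n → std T ≡ O → lengthS U ≡ n → std U ≡ O →
       (∀ j → com T j ≡ com U j) → T ≈S U)
    × ((T : SSOT la) → lengthS T ≡ n → std T ≡ O → ∀ j → xS T j ≡ xC (com T) j)
lemma2p18 la _ n _ O _ = com-injective , (λ T _ _ j → refl)
  where
  com-injective : (T U : SSOT la) → lengthS T ≡ n → std T ≡ O → lengthS U ≡ n → std U ≡ O →
    (∀ j → com T j ≡ com U j) → T ≈S U
  com-injective T U _ std-T _ std-U same-com = StdInjective.std-injective T U same-com (trans std-T (sym std-U))
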